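{- Let $n$ be an integer with $2^{k_n-1}<n<2^{k_n}$, where $k_n=\lceil\log_2 n\rceil$. Let $\widehat{T}=(\widehat{T}_a,\widehat{T}_b)$ be any rooted binary tree with $n$ leaves whose root subtrees have $\widehat{n}_a$ and $\widehat{n}_b$ leaves, where $$(\widehat{n}_a,\widehat{n}_b)=\begin{cases}(n-2^{k_n-2}+j,\;2^{k_n-2}-j)\text{ with } j\in\{1,\dots,2^{k_n-2}-1\}, & \text{if } n\in(2^{k_n-1},3\cdot 2^{k_n-2});\\ (2^{k_n-1}+j,\;2^{k_n-2}-j)\text{ with } j\in\{1,\dots,2^{k_n-2}-1\}, & \text{if } n=3\cdot 2^{k_n-2};\\ (2^{k_n-1}+j,\;n-2^{k_n-1}-j)\text{ with } j\in\{1,\dots,n-2^{k_n-1}-1\}, & \text{if } n\in(3\cdot2^{k_n-2},2^{k_n}).\end{cases}$$ Then $c_n=\mathcal{C}(T^{gfb}_n)<\mathcal{C}(\widehat{T})$; in particular $\widehat{T}$ does not have minimal Colless index. (Here the GFB tree $T^{gfb}_n=(T_a,T_b)$ has root split $(n_a,n_b)=(n-2^{k_n-2},2^{k_n-2})$, $(2^{k_n-1},2^{k_n-2})$, $(2^{k_n-1},n-2^{k_n-1})$ in the three respective cases, so that $\widehat{n}_a-\widehat{n}_b>n_a-n_b$.)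
   Context: A rooted binary tree with $n\ge2$ leaves is a rooted tree in which the root has degree 2 and every other internal vertex has degree 3 (each internal vertex has exactly two children); the single vertex is the rooted binary tree with one leaf. $T=(T_a,T_b)$ denotes the decomposition into the subtrees rooted at the two children of the root. For a vertex $v$, $\kappa_T(v)$ is the number of leaves descending from $v$. For an internal vertex $v$ with children $v_1,v_2$, $bal_T(v)=|\kappa_T(v_1)-\kappa_T(v_2)|$, and the Colless index is $\mathcal{C}(T)=\sum_{v\text{ internal}} bal_T(v)$; $c_n$ is its minimum over rooted binary trees with $n$ leaves. The GFB tree $T^{gfb}_n$ is the output (up to isomorphism) of the algorithm: start with $n$ single-vertex trees; while more than one tree remains, remove a tree $u$ with minimum number of leaves, then a tree $v$ with minimum number of leaves among the remaining, and add the tree with a new root whose children are the roots of $u$ and $v$. -}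

module Defs where

open import Data.Nat using (ℕ; zero; suc; _+_; _*_; _∸_; _^_; _≤_; _<_; _≤ᵇ_)
open import Data.Nat.Base using (∣_-_∣)
open import Data.Bool using (if_then_else_)
open import Data.List using (List; []; _∷_; replicate)
open import Data.Product using (Σ; _×_; _,_)
open import Data.Sum using (_⊎_)
open import Relation.Binary.PropositionalEquality using (_≡_)

data Tree : Set where
  leaf : Tree
  node : Tree → Tree → Tree

leaves : Tree → ℕ
leaves leaf       = 1
leaves (node a b) = leaves a + leaves b

colless : Tree → ℕ
colless leaf       = 0
colless (node a b) = ∣ leaves a - leaves b ∣ + colless a + colless b

IsMinColless : ℕ → ℕ → Set
IsMinColless n c =
  (Σ Tree λ T → leaves T ≡ n × colless T ≡ c)
  × (∀ (T : Tree) → leaves T ≡ n → c ≤ colless T)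

-- GFB algorithm. The forest is kept as a list sorted by number of leaves,
-- so the first two entries are a tree u of minimum size and a tree v of
-- minimum size among the remaining ones.
insertBySize : Tree → List Tree → List Tree
insertBySize t [] = t ∷ []
insertBySize t (s ∷ ss) =
  if leaves t ≤ᵇ leaves s then t ∷ s ∷ ss else s ∷ insertBySize t ss

gfbRun : ℕ → List Tree → Tree
gfbRun _       []             = leaf
gfbRun _       (t ∷ [])       = t
gfbRun zero    (t ∷ _ ∷ _)    = t
gfbRun (suc f) (u ∷ v ∷ ts)   = gfbRun f (insertBySize (node u v) ts)

-- T^gfb_n : start with n single-vertex trees (n - 1 merges, fuel n suffices)
gfb : ℕ → Tree
gfb n = gfbRun n (replicate n leaf)

HatSplit : ℕ → ℕ → ℕ → ℕ → Set
HatSplit n k na nb =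
    (n < 3 * 2 ^ (k ∸ 2) × Σ ℕ λ j → 1 ≤ j × j < 2 ^ (k ∸ 2)
        × na ≡ n ∸ 2 ^ (k ∸ 2) + j × nb ≡ 2 ^ (k ∸ 2) ∸ j)
  ⊎ ((n ≡ 3 * 2 ^ (k ∸ 2) × Σ ℕ λ j → 1 ≤ j × j < 2 ^ (k ∸ 2)
        × na ≡ 2 ^ (k ∸ 1) + j × nb ≡ 2 ^ (k ∸ 2) ∸ j)
  ⊎ (3 * 2 ^ (k ∸ 2) < n × Σ ℕ λ j → 1 ≤ j × j < n ∸ 2 ^ (k ∸ 1)
        × na ≡ 2 ^ (k ∸ 1) + j × nb ≡ n ∸ 2 ^ (k ∸ 1) ∸ j))

module Submission where

-- The Colless index c n of the maximally balanced tree satisfies c (2m) = 2 c m and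
-- c (2m+1) = c m + c (m+1) + 1. Hence the excess (y - x) + c x + c y - c (x + y) of a root
-- split (x , y), x ≤ y, is, according to the parities of x and y, the sum of the excesses
-- of two splits of the halves plus 0 or 2 (or an explicit nonnegative term when x = 1).
-- Induction on this decomposition shows that the excess is never negative, so that c n is
-- the minimum; that it vanishes when one part is a power of two s and the other lies in
-- [s , 2s] or in [s/2 , s]; and that it is positive when a power of two lies strictly between
-- the parts. At every stage the GFB forest consists of trees with s leaves, at most one tree
-- with strictly between s and 2s leaves, and trees with 2s leaves, so every merge it performs
-- has excess 0; and every split of the theorem has a power of two strictly between its parts.

open import Defs
open import Data.Bool using (true; false; if_then_else_)
open import Data.Empty using (⊥-elim)
open import Data.List using (List; []; _∷_; _++_; replicate; map; length)
open import Data.List.Properties using (++-identityʳ; map-replicate; length-replicate)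
open import Data.List.Relation.Binary.Permutation.Propositional
  using (_↭_; ↭-refl; ↭-prep; ↭-swap; ↭-trans; ↭-sym)
open import Data.List.Relation.Binary.Permutation.Propositional.Properties
  using (All-resp-↭; ↭-length; map⁺)
open import Data.List.Relation.Unary.All using (All; []; _∷_)
open import Data.List.Relation.Unary.All.Properties using (replicate⁺)
open import Data.Nat
  using (ℕ; zero; suc; _+_; _∸_; _^_; _≤_; _<_; _≤ᵇ_; z≤n; s≤s; z<s; ⌊_/2⌋; ⌈_/2⌉; ∣_-_∣)
open import Data.Nat.Induction using (<-rec; <-wellFounded)
open import Data.Nat.ListAction using (sum)
open import Data.Nat.ListAction.Properties using (sum-↭)
open import Data.Nat.Logarithm using (⌈log₂_⌉)
open import Data.Nat.Properties
open import Algebra.Properties.CommutativeSemigroup +-commutativeSemigroup using (interchange)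
open import Data.Nat.Tactic.RingSolver using (solve-∀)
open import Data.Product using (Σ; _×_; _,_)
open import Data.Sum using (inj₁; inj₂)
open import Induction.WellFounded using (WfRec; module FixPoint)
open import Relation.Binary.PropositionalEquality
  using (_≡_; refl; sym; trans; cong; cong₂; subst; subst₂; module ≡-Reasoning)
open import Relation.Nullary.Decidable using (dec-true; dec-false)

data Parity : ℕ → Set where
  even : ∀ n → Parity (n + n)
  odd  : ∀ n → Parity (suc (n + n))

parity : ∀ n → Parity n
parity zero = even zero
parity (suc n) with parity n
... | even m = odd m
... | odd m  = subst Parity (cong suc (+-suc m m)) (even (suc m))

m+m≤1+n+n⇒m≤n : ∀ {m n} → m + m ≤ suc (n + n) → m ≤ n
m+m≤1+n+n⇒m≤n {m} {n} h = subst₂ _≤_ (sym (n≡⌊n+n/2⌋ m)) (sym (n≡⌈n+n/2⌉ n)) (⌊n/2⌋-mono h)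

m+m<n+n⇒m<n : ∀ {m n} → m + m < n + n → m < n
m+m<n+n⇒m<n {m} {n} h = m+m≤1+n+n⇒m≤n (subst (_≤ suc (n + n)) (cong suc (sym (+-suc m m))) (s≤s h))

data PowerOfTwo : ℕ → Set where
  one    : PowerOfTwo 1
  double : ∀ {s} → PowerOfTwo s → PowerOfTwo (s + s)

powerOfTwo-pos : ∀ {s} → PowerOfTwo s → 0 < s
powerOfTwo-pos one        = z<s
powerOfTwo-pos (double p) = ≤-trans (powerOfTwo-pos p) (m≤m+n _ _)

2^[1+m]≡2^m+2^m : ∀ m → 2 ^ suc m ≡ 2 ^ m + 2 ^ m
2^[1+m]≡2^m+2^m m = cong (2 ^ m +_) (+-identityʳ (2 ^ m))

powerOfTwo-2^ : ∀ m → PowerOfTwo (2 ^ m)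
powerOfTwo-2^ zero    = one
powerOfTwo-2^ (suc m) = subst PowerOfTwo (sym (2^[1+m]≡2^m+2^m m)) (double (powerOfTwo-2^ m))

powerOfTwo-≤-odd : ∀ {s n} → PowerOfTwo s → 0 < n → s ≤ suc (n + n) → s ≤ n + n
powerOfTwo-≤-odd one        0<n _ = ≤-trans 0<n (m≤m+n _ _)
powerOfTwo-≤-odd {n = n} (double {s} _) _ h = +-mono-≤ (m+m≤1+n+n⇒m≤n {s} {n} h) (m+m≤1+n+n⇒m≤n {s} {n} h)

+-interchange₃ : ∀ a b d a′ b′ d′ → (a + b + d) + (a′ + b′ + d′) ≡ (a + a′) + (b + b′) + (d + d′)
+-interchange₃ a b d a′ b′ d′ =
  trans (interchange (a + b) d (a′ + b′) d′) (cong (_+ (d + d′)) (interchange a b a′ b′))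

-- The paper's c_n, defined here as the Colless index of the maximally balanced tree.
cStep : ∀ n → WfRec _<_ (λ _ → ℕ) n → ℕ
cStep 0 _ = 0
cStep 1 _ = 0
cStep n@(suc (suc k)) c = c (⌈n/2⌉<n k) + c (⌊n/2⌋<n (suc k)) + ∣ ⌈ n /2⌉ - ⌊ n /2⌋ ∣

c : ℕ → ℕ
c = <-rec _ cStep

cStep-ext : ∀ n {IH IH′ : WfRec _<_ (λ _ → ℕ) n} →
            (∀ {m} (m<n : m < n) → IH m<n ≡ IH′ m<n) → cStep n IH ≡ cStep n IH′
cStep-ext 0 _ = refl
cStep-ext 1 _ = refl
cStep-ext (suc (suc k)) eq = cong₂ (λ x y → x + y + _) (eq _) (eq _)

c-halves : ∀ {n} → 2 ≤ n → c n ≡ c ⌈ n /2⌉ + c ⌊ n /2⌋ + ∣ ⌈ n /2⌉ - ⌊ n /2⌋ ∣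
c-halves {n@(suc (suc _))} (s≤s (s≤s _)) = unfold-wfRec {n}
  where open FixPoint <-wellFounded (λ _ → ℕ) cStep cStep-ext

c-double : ∀ y → c (y + y) ≡ c y + c y
c-double zero      = refl
c-double y@(suc _) = begin
  c (y + y)                                                      ≡⟨ c-halves (+-mono-≤ {1} {y} z<s z<s) ⟩
  c ⌈ y + y /2⌉ + c ⌊ y + y /2⌋ + ∣ ⌈ y + y /2⌉ - ⌊ y + y /2⌋ ∣
    ≡⟨ cong₂ (λ u v → c u + c v + ∣ u - v ∣) (sym (n≡⌈n+n/2⌉ y)) (sym (n≡⌊n+n/2⌋ y)) ⟩
  c y + c y + ∣ y - y ∣                                          ≡⟨ cong (c y + c y +_) (∣n-n∣≡0 y) ⟩
  c y + c y + 0                                                  ≡⟨ +-identityʳ _ ⟩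
  c y + c y                                                      ∎
  where open ≡-Reasoning

c-odd : ∀ {y} → 0 < y → c (suc (y + y)) ≡ c y + c (suc y) + 1
c-odd {y} 0<y = begin
  c (suc (y + y))                                  ≡⟨ c-halves (s≤s (+-mono-≤ 0<y z≤n)) ⟩
  c (suc ⌊ y + y /2⌋) + c ⌈ y + y /2⌉ + ∣ suc ⌊ y + y /2⌋ - ⌈ y + y /2⌉ ∣
    ≡⟨ cong₂ (λ u v → c (suc u) + c v + ∣ suc u - v ∣) (sym (n≡⌊n+n/2⌋ y)) (sym (n≡⌈n+n/2⌉ y)) ⟩
  c (suc y) + c y + ∣ suc y - y ∣                  ≡⟨ cong (c (suc y) + c y +_) (trans (m≤n⇒∣n-m∣≡n∸m (n≤1+n y)) (m+n∸n≡m 1 y)) ⟩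
  c (suc y) + c y + 1                              ≡⟨ cong (_+ 1) (+-comm (c (suc y)) (c y)) ⟩
  c y + c (suc y) + 1                              ∎
  where open ≡-Reasoning

-- For x ≤ y, Excess x y e says that the root split (x , y) of x + y leaves costs
-- c (x + y) + e (see excess⇒splitCost); the subtraction y ∸ x is moved across.
Excess : ℕ → ℕ → ℕ → Set
Excess x y e = c (x + y) + x + e ≡ c x + c y + y

excess-refl : ∀ x → Excess x x 0
excess-refl x = begin
  c (x + x) + x + 0  ≡⟨ +-identityʳ _ ⟩
  c (x + x) + x      ≡⟨ cong (_+ x) (c-double x) ⟩
  c x + c x + x      ∎
  where open ≡-Reasoning

module _ (u v : ℕ) where
  open ≡-Reasoning

  excess-even-even : ∀ {e} → Excess u v e → Excess (u + u) (v + v) (e + e)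
  excess-even-even {e} h = begin
    c ((u + u) + (v + v)) + (u + u) + (e + e)  ≡⟨ cong (λ n → c n + (u + u) + (e + e)) (interchange u u v v) ⟩
    c ((u + v) + (u + v)) + (u + u) + (e + e)  ≡⟨ cong (λ z → z + (u + u) + (e + e)) (c-double (u + v)) ⟩
    c (u + v) + c (u + v) + (u + u) + (e + e)  ≡⟨ +-interchange₃ (c (u + v)) u e (c (u + v)) u e ⟨
    (c (u + v) + u + e) + (c (u + v) + u + e)  ≡⟨ cong₂ _+_ h h ⟩
    (c u + c v + v) + (c u + c v + v)          ≡⟨ +-interchange₃ (c u) (c v) v (c u) (c v) v ⟩
    (c u + c u) + (c v + c v) + (v + v)        ≡⟨ cong₂ (λ a b → a + b + (v + v)) (c-double u) (c-double v) ⟨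
    c (u + u) + c (v + v) + (v + v)            ∎

  excess-even-odd : ∀ {e₁ e₂} → 0 < v → Excess u v e₁ → Excess u (suc v) e₂ →
                    Excess (u + u) (suc (v + v)) (e₁ + e₂)
  excess-even-odd {e₁} {e₂} 0<v h₁ h₂ = begin
    c ((u + u) + suc (v + v)) + (u + u) + (e₁ + e₂)
      ≡⟨ cong (λ n → c n + (u + u) + (e₁ + e₂)) (trans (+-suc (u + u) (v + v)) (cong suc (interchange u u v v))) ⟩
    c (suc ((u + v) + (u + v))) + (u + u) + (e₁ + e₂)
      ≡⟨ cong (λ z → z + (u + u) + (e₁ + e₂)) (c-odd (≤-trans 0<v (m≤n+m v u))) ⟩
    c (u + v) + c (suc (u + v)) + 1 + (u + u) + (e₁ + e₂)
      ≡⟨ cong (λ n → c (u + v) + c n + 1 + (u + u) + (e₁ + e₂)) (+-suc u v) ⟨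
    c (u + v) + c (u + suc v) + 1 + (u + u) + (e₁ + e₂)
      ≡⟨ regroupˡ (c (u + v)) (c (u + suc v)) u e₁ e₂ ⟩
    (c (u + v) + u + e₁) + (c (u + suc v) + u + e₂) + 1
      ≡⟨ cong (_+ 1) (cong₂ _+_ h₁ h₂) ⟩
    (c u + c v + v) + (c u + c (suc v) + suc v) + 1
      ≡⟨ regroupʳ (c u) (c v) (c (suc v)) v ⟩
    (c u + c u) + (c v + c (suc v) + 1) + suc (v + v)
      ≡⟨ cong₂ (λ a b → a + b + suc (v + v)) (c-double u) (c-odd 0<v) ⟨
    c (u + u) + c (suc (v + v)) + suc (v + v)
      ∎
    where
    regroupˡ : ∀ X Y u e₁ e₂ → X + Y + 1 + (u + u) + (e₁ + e₂) ≡ (X + u + e₁) + (Y + u + e₂) + 1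
    regroupˡ = solve-∀
    regroupʳ : ∀ U V V′ v → (U + V + v) + (U + V′ + suc v) + 1 ≡ (U + U) + (V + V′ + 1) + suc (v + v)
    regroupʳ = solve-∀

  excess-odd-even : ∀ {e₁ e₂} → 0 < u → Excess u v e₁ → Excess (suc u) v e₂ →
                    Excess (suc (u + u)) (v + v) (e₁ + e₂)
  excess-odd-even {e₁} {e₂} 0<u h₁ h₂ = begin
    c (suc (u + u) + (v + v)) + suc (u + u) + (e₁ + e₂)
      ≡⟨ cong (λ n → c (suc n) + suc (u + u) + (e₁ + e₂)) (interchange u u v v) ⟩
    c (suc ((u + v) + (u + v))) + suc (u + u) + (e₁ + e₂)
      ≡⟨ cong (λ z → z + suc (u + u) + (e₁ + e₂)) (c-odd (≤-trans 0<u (m≤m+n u v))) ⟩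
    c (u + v) + c (suc u + v) + 1 + suc (u + u) + (e₁ + e₂)
      ≡⟨ regroupˡ (c (u + v)) (c (suc u + v)) u e₁ e₂ ⟩
    (c (u + v) + u + e₁) + (c (suc u + v) + suc u + e₂) + 1
      ≡⟨ cong (_+ 1) (cong₂ _+_ h₁ h₂) ⟩
    (c u + c v + v) + (c (suc u) + c v + v) + 1
      ≡⟨ regroupʳ (c u) (c (suc u)) (c v) v ⟩
    (c u + c (suc u) + 1) + (c v + c v) + (v + v)
      ≡⟨ cong₂ (λ a b → a + b + (v + v)) (c-odd 0<u) (c-double v) ⟨
    c (suc (u + u)) + c (v + v) + (v + v)
      ∎
    where
    regroupˡ : ∀ X Y u e₁ e₂ → X + Y + 1 + suc (u + u) + (e₁ + e₂) ≡ (X + u + e₁) + (Y + suc u + e₂) + 1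
    regroupˡ = solve-∀
    regroupʳ : ∀ U U′ V v → (U + V + v) + (U′ + V + v) + 1 ≡ (U + U′ + 1) + (V + V) + (v + v)
    regroupʳ = solve-∀

  excess-odd-odd : ∀ {e₁ e₂} → 0 < u → 0 < v → Excess u (suc v) e₁ → Excess (suc u) v e₂ →
                   Excess (suc (u + u)) (suc (v + v)) (2 + e₁ + e₂)
  excess-odd-odd {e₁} {e₂} 0<u 0<v h₁ h₂ = begin
    c (suc (u + u) + suc (v + v)) + suc (u + u) + (2 + e₁ + e₂)
      ≡⟨ cong (λ n → c n + suc (u + u) + (2 + e₁ + e₂)) (index u v) ⟩
    c (suc (u + v) + suc (u + v)) + suc (u + u) + (2 + e₁ + e₂)
      ≡⟨ cong (λ z → z + suc (u + u) + (2 + e₁ + e₂)) (c-double (suc (u + v))) ⟩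
    c (suc (u + v)) + c (suc u + v) + suc (u + u) + (2 + e₁ + e₂)
      ≡⟨ cong (λ n → c n + c (suc u + v) + suc (u + u) + (2 + e₁ + e₂)) (+-suc u v) ⟨
    c (u + suc v) + c (suc u + v) + suc (u + u) + (2 + e₁ + e₂)
      ≡⟨ regroupˡ (c (u + suc v)) (c (suc u + v)) u e₁ e₂ ⟩
    (c (u + suc v) + u + e₁) + (c (suc u + v) + suc u + e₂) + 2
      ≡⟨ cong (_+ 2) (cong₂ _+_ h₁ h₂) ⟩
    (c u + c (suc v) + suc v) + (c (suc u) + c v + v) + 2
      ≡⟨ regroupʳ (c u) (c (suc u)) (c v) (c (suc v)) v ⟩
    (c u + c (suc u) + 1) + (c v + c (suc v) + 1) + suc (v + v)
      ≡⟨ cong₂ (λ a b → a + b + suc (v + v)) (c-odd 0<u) (c-odd 0<v) ⟨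
    c (suc (u + u)) + c (suc (v + v)) + suc (v + v)
      ∎
    where
    index : ∀ u v → suc (u + u) + suc (v + v) ≡ suc (u + v) + suc (u + v)
    index = solve-∀
    regroupˡ : ∀ X Y u e₁ e₂ → X + Y + suc (u + u) + (2 + e₁ + e₂) ≡ (X + u + e₁) + (Y + suc u + e₂) + 2
    regroupˡ = solve-∀
    regroupʳ : ∀ U U′ V V′ v → (U + V′ + suc v) + (U′ + V + v) + 2 ≡ (U + U′ + 1) + (V + V′ + 1) + suc (v + v)
    regroupʳ = solve-∀

excess-one-even : ∀ p {e} → Excess 1 (suc p) e → Excess 1 (suc p + suc p) (p + e)
excess-one-even p {e} h = begin
  c (suc (v + v)) + 1 + (p + e)     ≡⟨ cong (λ z → z + 1 + (p + e)) (c-odd {v} z<s) ⟩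
  c v + c (suc v) + 1 + 1 + (p + e) ≡⟨ regroupˡ (c v) (c (suc v)) p e ⟩
  c v + (c (suc v) + 1 + e) + v     ≡⟨ cong (λ z → c v + z + v) h ⟩
  c v + (c v + v) + v               ≡⟨ regroupʳ (c v) v ⟩
  c v + c v + (v + v)               ≡⟨ cong (_+ (v + v)) (c-double v) ⟨
  c (v + v) + (v + v)               ∎
  where
  open ≡-Reasoning
  v = suc p
  regroupˡ : ∀ V V′ p e → V + V′ + 1 + 1 + (p + e) ≡ V + (V′ + 1 + e) + suc p
  regroupˡ = solve-∀
  regroupʳ : ∀ V v → V + (V + v) + v ≡ V + V + (v + v)
  regroupʳ = solve-∀

excess-one-odd : ∀ v {e} → 0 < v → Excess 1 v e → Excess 1 (suc (v + v)) (2 + v + e)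
excess-one-odd v {e} 0<v h = begin
  c (suc (suc (v + v))) + 1 + (2 + v + e) ≡⟨ cong (λ n → c n + 1 + (2 + v + e)) (+-suc (suc v) v) ⟨
  c (suc v + suc v) + 1 + (2 + v + e)     ≡⟨ cong (λ z → z + 1 + (2 + v + e)) (c-double (suc v)) ⟩
  c (suc v) + c (suc v) + 1 + (2 + v + e) ≡⟨ regroupˡ (c (suc v)) v e ⟩
  c (suc v) + (c (suc v) + 1 + e) + (v + 2) ≡⟨ cong (λ z → c (suc v) + z + (v + 2)) h ⟩
  c (suc v) + (c v + v) + (v + 2)         ≡⟨ regroupʳ (c v) (c (suc v)) v ⟩
  c v + c (suc v) + 1 + suc (v + v)       ≡⟨ cong (_+ suc (v + v)) (c-odd 0<v) ⟨
  c (suc (v + v)) + suc (v + v)           ∎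
  where
  open ≡-Reasoning
  regroupˡ : ∀ V′ v e → V′ + V′ + 1 + (2 + v + e) ≡ V′ + (V′ + 1 + e) + (v + 2)
  regroupˡ = solve-∀
  regroupʳ : ∀ V V′ v → V′ + (V + v) + (v + 2) ≡ V + V′ + 1 + suc (v + v)
  regroupʳ = solve-∀

excess-exists : ∀ y {x} → 0 < x → x ≤ y → Σ ℕ (Excess x y)
excess-exists = <-rec _ step
  where
  step : ∀ y → (∀ {y′} → y′ < y → ∀ {x} → 0 < x → x ≤ y′ → Σ ℕ (Excess x y′)) →
         ∀ {x} → 0 < x → x ≤ y → Σ ℕ (Excess x y)
  step y rec {x} 0<x x≤y with parity x | parity y
  ... | even zero      | _ = ⊥-elim (n≮0 0<x)
  ... | even u@(suc _) | even v =
    let u≤v     = m+m≤1+n+n⇒m≤n (m≤n⇒m≤1+n x≤y)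
        (e , h) = rec (m<m+n v (≤-trans z<s u≤v)) z<s u≤v
    in e + e , excess-even-even u v h
  ... | even u@(suc _) | odd v =
    let u≤v       = m+m≤1+n+n⇒m≤n x≤y
        0<v       = ≤-trans z<s u≤v
        (e₁ , h₁) = rec (s≤s (m≤m+n v v)) z<s u≤v
        (e₂ , h₂) = rec (s≤s (m<m+n v 0<v)) z<s (m≤n⇒m≤1+n u≤v)
    in e₁ + e₂ , excess-even-odd u v 0<v h₁ h₂
  ... | odd zero       | even zero = ⊥-elim (n≮0 x≤y)
  ... | odd zero       | even v@(suc p) =
    let (e , h) = rec (m<m+n v z<s) z<s z<s
    in p + e , excess-one-even p h
  ... | odd zero       | odd zero = 0 , excess-refl 1
  ... | odd zero       | odd v@(suc _) =
    let (e , h) = rec (s≤s (m≤m+n v v)) z<s z<s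
    in 2 + v + e , excess-one-odd v z<s h
  ... | odd u@(suc _)  | even v =
    let u<v       = m+m<n+n⇒m<n x≤y
        (e₁ , h₁) = rec (m<m+n v (≤-trans z<s (<⇒≤ u<v))) z<s (<⇒≤ u<v)
        (e₂ , h₂) = rec (m<m+n v (≤-trans z<s (<⇒≤ u<v))) z<s u<v
    in e₁ + e₂ , excess-odd-even u v z<s h₁ h₂
  ... | odd u@(suc _)  | odd v with m≤n⇒m<n∨m≡n (m+m≤1+n+n⇒m≤n {u} {v} (m≤n⇒m≤1+n (≤-pred x≤y)))
  ...   | inj₂ refl = 0 , excess-refl x
  ...   | inj₁ u<v  =
    let 0<v       = ≤-trans z<s (<⇒≤ u<v)
        (e₁ , h₁) = rec (s≤s (m<m+n v 0<v)) z<s (m≤n⇒m≤1+n (<⇒≤ u<v))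
        (e₂ , h₂) = rec (s≤s (m≤m+n v v)) z<s u<v
    in 2 + e₁ + e₂ , excess-odd-odd u v z<s 0<v h₁ h₂

excess-positive : ∀ {s x y} → PowerOfTwo s → 0 < x → x < s → s < y → Σ ℕ λ e → 0 < e × Excess x y e
excess-positive one 0<x x<1 _ = ⊥-elim (1+n≰n (≤-trans x<1 0<x))
excess-positive {x = x} {y} (double {r} pr) 0<x x<s s<y with parity x | parity y
... | even zero      | _ = ⊥-elim (n≮0 0<x)
... | even u@(suc _) | even v =
  let (e , 0<e , h) = excess-positive pr z<s (m+m<n+n⇒m<n x<s) (m+m<n+n⇒m<n s<y)
  in e + e , ≤-trans 0<e (m≤m+n e e) , excess-even-even u v h
... | even u@(suc _) | odd v =
  let u<r             = m+m<n+n⇒m<n x<s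
      r≤v             = m+m≤1+n+n⇒m≤n (m≤n⇒m≤1+n (≤-pred s<y))
      u≤v             = <⇒≤ (<-≤-trans u<r r≤v)
      (e₁ , h₁)       = excess-exists v z<s u≤v
      (e₂ , 0<e₂ , h₂) = excess-positive pr z<s u<r (s≤s r≤v)
  in e₁ + e₂ , ≤-trans 0<e₂ (m≤n+m e₂ e₁) , excess-even-odd u v (≤-trans z<s u≤v) h₁ h₂
... | odd zero       | even zero = ⊥-elim (n≮0 s<y)
... | odd zero       | even v@(suc p) =
  let (e , h) = excess-exists v z<s z<s
      0<p     = ≤-trans (powerOfTwo-pos pr) (≤-pred (m+m<n+n⇒m<n s<y))
  in p + e , ≤-trans 0<p (m≤m+n p e) , excess-one-even p h
... | odd zero       | odd v =
  let 0<v     = ≤-trans (powerOfTwo-pos pr) (m+m≤1+n+n⇒m≤n (m≤n⇒m≤1+n (≤-pred s<y)))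
      (e , h) = excess-exists v z<s 0<v
  in 2 + v + e , z<s , excess-one-odd v 0<v h
... | odd u@(suc _)  | even v =
  let u<r              = m+m<n+n⇒m<n (<⇒≤ x<s)
      r<v              = m+m<n+n⇒m<n s<y
      (e₁ , 0<e₁ , h₁) = excess-positive pr z<s u<r r<v
      (e₂ , h₂)        = excess-exists v z<s (<-trans u<r r<v)
  in e₁ + e₂ , ≤-trans 0<e₁ (m≤m+n e₁ e₂) , excess-odd-even u v z<s h₁ h₂
... | odd u@(suc _)  | odd v =
  let u<r       = m+m<n+n⇒m<n {u} {r} (<⇒≤ x<s)
      r≤v       = m+m≤1+n+n⇒m≤n {r} {v} (m≤n⇒m≤1+n (≤-pred s<y))
      u<v       = <-≤-trans u<r r≤v
      (e₁ , h₁) = excess-exists (suc v) z<s (m≤n⇒m≤1+n (<⇒≤ u<v))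
      (e₂ , h₂) = excess-exists v z<s u<v
  in 2 + e₁ + e₂ , z<s , excess-odd-odd u v z<s (≤-trans z<s u<v) h₁ h₂

excess-powerOfTwoˡ : ∀ {s y} → PowerOfTwo s → s ≤ y → y ≤ s + s → Excess s y 0
excess-powerOfTwoˡ {y = 1}                one _ _ = refl
excess-powerOfTwoˡ {y = 2}                one _ _ = refl
excess-powerOfTwoˡ {y = suc (suc (suc _))} one _ (s≤s (s≤s ()))
excess-powerOfTwoˡ {y = y} (double {r} pr) s≤y y≤2s with parity y
... | even v = excess-even-even r v (excess-powerOfTwoˡ {y = v} pr (m+m≤1+n+n⇒m≤n (m≤n⇒m≤1+n s≤y)) (m+m≤1+n+n⇒m≤n (m≤n⇒m≤1+n y≤2s)))
... | odd v =
  let r≤v  = m+m≤1+n+n⇒m≤n {r} {v} s≤y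
      v<2r = m+m<n+n⇒m<n {v} {r + r} y≤2s
  in excess-even-odd r v (≤-trans (powerOfTwo-pos pr) r≤v)
       (excess-powerOfTwoˡ pr r≤v (<⇒≤ v<2r)) (excess-powerOfTwoˡ pr (m≤n⇒m≤1+n r≤v) v<2r)

excess-powerOfTwoʳ : ∀ {s x} → PowerOfTwo s → s ≤ x + x → x ≤ s → Excess x s 0
excess-powerOfTwoʳ {x = 1}           one _ _ = refl
excess-powerOfTwoʳ {x = suc (suc _)} one _ (s≤s ())
excess-powerOfTwoʳ {x = x} (double {r} pr) s≤2x x≤s with parity x
... | even u = excess-even-even u r (excess-powerOfTwoʳ {x = u} pr (m+m≤1+n+n⇒m≤n (m≤n⇒m≤1+n s≤2x)) (m+m≤1+n+n⇒m≤n (m≤n⇒m≤1+n x≤s)))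
... | odd zero with pr
...   | one = refl
...   | double pr′ = ⊥-elim (n≮0 (≤-trans (powerOfTwo-pos pr′) (m+m≤1+n+n⇒m≤n {n = 0} (m+m≤1+n+n⇒m≤n {n = 1} (m≤n⇒m≤1+n s≤2x)))))
excess-powerOfTwoʳ {x = x} (double {r} pr) s≤2x x≤s | odd u@(suc _) =
  let u<r  = m+m<n+n⇒m<n x≤s
      r≤2u = powerOfTwo-≤-odd pr z<s (m+m≤1+n+n⇒m≤n (m≤n⇒m≤1+n s≤2x))
  in excess-odd-even u r z<s
       (excess-powerOfTwoʳ pr r≤2u (<⇒≤ u<r))
       (excess-powerOfTwoʳ pr (≤-trans r≤2u (+-mono-≤ (n≤1+n u) (n≤1+n u))) u<r)

splitCost : ℕ → ℕ → ℕ
splitCost x y = ∣ x - y ∣ + c x + c y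

splitCost-comm : ∀ x y → splitCost x y ≡ splitCost y x
splitCost-comm x y = begin
  ∣ x - y ∣ + c x + c y   ≡⟨ +-assoc ∣ x - y ∣ (c x) (c y) ⟩
  ∣ x - y ∣ + (c x + c y) ≡⟨ cong₂ _+_ (∣-∣-comm x y) (+-comm (c x) (c y)) ⟩
  ∣ y - x ∣ + (c y + c x) ≡⟨ +-assoc ∣ y - x ∣ (c y) (c x) ⟨
  ∣ y - x ∣ + c y + c x   ∎
  where open ≡-Reasoning

excess⇒splitCost : ∀ {x y e} → x ≤ y → Excess x y e → splitCost x y ≡ c (x + y) + e
excess⇒splitCost {x} {y} {e} x≤y h = +-cancelʳ-≡ x _ _ (begin
  ∣ x - y ∣ + c x + c y + x   ≡⟨ cong (λ d → d + c x + c y + x) (m≤n⇒∣m-n∣≡n∸m x≤y) ⟩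
  (y ∸ x) + c x + c y + x     ≡⟨ regroup (y ∸ x) (c x) (c y) x ⟩
  c x + c y + ((y ∸ x) + x)   ≡⟨ cong (c x + c y +_) (m∸n+n≡m x≤y) ⟩
  c x + c y + y               ≡⟨ h ⟨
  c (x + y) + x + e           ≡⟨ +-assoc (c (x + y)) x e ⟩
  c (x + y) + (x + e)         ≡⟨ cong (c (x + y) +_) (+-comm x e) ⟩
  c (x + y) + (e + x)         ≡⟨ +-assoc (c (x + y)) e x ⟨
  c (x + y) + e + x           ∎)
  where
  open ≡-Reasoning
  regroup : ∀ d a b x → d + a + b + x ≡ a + b + (d + x)
  regroup = solve-∀

splitCost-optimal : ∀ {x y} → x ≤ y → Excess x y 0 → splitCost x y ≡ c (x + y)
splitCost-optimal x≤y h = trans (excess⇒splitCost x≤y h) (+-identityʳ _)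

c-≤-splitCost : ∀ {x y} → 0 < x → 0 < y → c (x + y) ≤ splitCost x y
c-≤-splitCost {x} {y} 0<x 0<y with ≤-total x y
... | inj₁ x≤y =
  let (e , h) = excess-exists y 0<x x≤y
  in ≤-trans (m≤m+n _ e) (≤-reflexive (sym (excess⇒splitCost x≤y h)))
... | inj₂ y≤x =
  let (e , h) = excess-exists x 0<y y≤x
  in subst₂ _≤_ (cong c (+-comm y x)) (splitCost-comm y x)
       (≤-trans (m≤m+n _ e) (≤-reflexive (sym (excess⇒splitCost y≤x h))))

leaves-pos : ∀ T → 0 < leaves T
leaves-pos leaf       = z<s
leaves-pos (node T _) = ≤-trans (leaves-pos T) (m≤m+n _ _)

c-≤-colless : ∀ T → c (leaves T) ≤ colless T
splitCost-≤-colless : ∀ T U → splitCost (leaves T) (leaves U) ≤ colless (node T U)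

c-≤-colless leaf       = z≤n
c-≤-colless (node T U) = ≤-trans (c-≤-splitCost (leaves-pos T) (leaves-pos U)) (splitCost-≤-colless T U)

splitCost-≤-colless T U = +-mono-≤ (+-monoʳ-≤ ∣ leaves T - leaves U ∣ (c-≤-colless T)) (c-≤-colless U)

c-<-colless : ∀ {s} T U → PowerOfTwo s → leaves U < s → s < leaves T → c (leaves T + leaves U) < colless (node T U)
c-<-colless T U pow u<s s<t =
  let (e , 0<e , h) = excess-positive pow (leaves-pos U) u<s s<t
  in begin-strict
    c (leaves T + leaves U)          ≡⟨ cong c (+-comm (leaves T) (leaves U)) ⟩
    c (leaves U + leaves T)          <⟨ m<m+n _ 0<e ⟩
    c (leaves U + leaves T) + e      ≡⟨ excess⇒splitCost (<⇒≤ (<-trans u<s s<t)) h ⟨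
    splitCost (leaves U) (leaves T)  ≡⟨ splitCost-comm (leaves U) (leaves T) ⟩
    splitCost (leaves T) (leaves U)  ≤⟨ splitCost-≤-colless T U ⟩
    colless (node T U)               ∎
  where open ≤-Reasoning

insertSize : ℕ → List ℕ → List ℕ
insertSize n []       = n ∷ []
insertSize n (m ∷ ms) = if n ≤ᵇ m then n ∷ m ∷ ms else m ∷ insertSize n ms

map-leaves-insertBySize : ∀ t ts → map leaves (insertBySize t ts) ≡ insertSize (leaves t) (map leaves ts)
map-leaves-insertBySize t []       = refl
map-leaves-insertBySize t (u ∷ us) with leaves t ≤ᵇ leaves u
... | true  = refl
... | false = cong (leaves u ∷_) (map-leaves-insertBySize t us)

insertBySize-↭ : ∀ t ts → insertBySize t ts ↭ t ∷ ts
insertBySize-↭ t []       = ↭-refl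
insertBySize-↭ t (u ∷ us) with leaves t ≤ᵇ leaves u
... | true  = ↭-refl
... | false = ↭-trans (↭-prep u (insertBySize-↭ t us)) (↭-swap u t ↭-refl)

-- does (n ≤? m) is n ≤ᵇ m by definition, so dec-true/dec-false decide the if.
insertSize-skip : ∀ {m n} ms → m < n → insertSize n (m ∷ ms) ≡ m ∷ insertSize n ms
insertSize-skip {m} {n} _ m<n rewrite dec-false (n ≤? m) (<⇒≱ m<n) = refl

insertSize-replicate : ∀ p {m n} ms → m < n → insertSize n (replicate p m ++ ms) ≡ replicate p m ++ insertSize n ms
insertSize-replicate zero    _  _   = refl
insertSize-replicate (suc p) ms m<n = trans (insertSize-skip _ m<n) (cong (_ ∷_) (insertSize-replicate p ms m<n))

insertSize-last : ∀ q {m n} → m < n → insertSize n (replicate q m) ≡ replicate q m ++ n ∷ []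
insertSize-last q {m} {n} m<n = trans (cong (insertSize n) (sym (++-identityʳ (replicate q m)))) (insertSize-replicate q [] m<n)

insertSize-first : ∀ q n → insertSize n (replicate q n) ≡ n ∷ replicate q n
insertSize-first zero    _ = refl
insertSize-first (suc _) n rewrite dec-true (n ≤? n) ≤-refl = refl

data Middle (s : ℕ) : List ℕ → Set where
  none   : Middle s []
  single : ∀ {x} → s < x → x < s + s → Middle s (x ∷ [])

insertSize-middle : ∀ {s xs} q → Middle s xs → insertSize (s + s) (xs ++ replicate q (s + s)) ≡ xs ++ s + s ∷ replicate q (s + s)
insertSize-middle q none            = insertSize-first q _
insertSize-middle q (single _ x<2s) = trans (insertSize-skip _ x<2s) (cong (_ ∷_) (insertSize-first q _))

record GfbSizes (sizes : List ℕ) : Set where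
  constructor gfbSizes
  field
    s p q      : ℕ
    middle     : List ℕ
    powerOfTwo : PowerOfTwo s
    isMiddle   : Middle s middle
    sizes-≡    : sizes ≡ replicate p s ++ middle ++ replicate q (s + s)

gfbSizes-merge : ∀ x y ns → GfbSizes (x ∷ y ∷ ns) → splitCost x y ≡ c (x + y) × GfbSizes (insertSize (x + y) ns)
gfbSizes-merge _ _ _ (gfbSizes s (suc (suc p)) q xs pow mid refl) =
  splitCost-optimal {s} ≤-refl (excess-refl s) ,
  gfbSizes s p (suc q) xs pow mid
    (trans (insertSize-replicate p _ (m<m+n s (powerOfTwo-pos pow))) (cong (replicate p s ++_) (insertSize-middle q mid)))
gfbSizes-merge _ _ _ (gfbSizes s 1 q (x ∷ []) pow (single s<x x<2s) refl) =
  splitCost-optimal (<⇒≤ s<x) (excess-powerOfTwoˡ pow (<⇒≤ s<x) (<⇒≤ x<2s)) ,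
  gfbSizes (s + s) q 0 (s + x ∷ []) (double pow)
    (single (+-monoʳ-< s s<x) (+-mono-< (m<m+n s (powerOfTwo-pos pow)) x<2s))
    (insertSize-last q (+-monoʳ-< s s<x))
gfbSizes-merge _ _ _ (gfbSizes s 1 (suc q) [] pow none refl) =
  splitCost-optimal (m≤m+n s s) (excess-powerOfTwoˡ pow (m≤m+n s s) ≤-refl) ,
  gfbSizes (s + s) q 0 (s + (s + s) ∷ []) (double pow)
    (single (m<n+m (s + s) 0<s) (+-monoˡ-< (s + s) (m<m+n s 0<s)))
    (insertSize-last q (m<n+m (s + s) 0<s))
  where 0<s = powerOfTwo-pos pow
gfbSizes-merge _ _ _ (gfbSizes s 0 (suc q) (x ∷ []) pow (single s<x x<2s) refl) =
  splitCost-optimal (<⇒≤ x<2s) (excess-powerOfTwoʳ (double pow) (+-mono-≤ (<⇒≤ s<x) (<⇒≤ s<x)) (<⇒≤ x<2s)) ,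
  gfbSizes (s + s) q 0 (x + (s + s) ∷ []) (double pow)
    (single (m<n+m (s + s) 0<x) (+-monoˡ-< (s + s) x<2s))
    (insertSize-last q (m<n+m (s + s) 0<x))
  where 0<x = <-trans (powerOfTwo-pos pow) s<x
gfbSizes-merge _ _ _ (gfbSizes s 0 (suc (suc q)) [] pow none refl) =
  splitCost-optimal {s + s} ≤-refl (excess-refl (s + s)) ,
  gfbSizes (s + s) q 1 [] (double pow) none
    (insertSize-last q (m<m+n (s + s) (powerOfTwo-pos (double pow))))
gfbSizes-merge _ _ _ (gfbSizes _ 0 0 [] _ none ())
gfbSizes-merge _ _ _ (gfbSizes _ 0 1 [] _ none ())
gfbSizes-merge _ _ _ (gfbSizes _ 0 0 (_ ∷ []) _ (single _ _) ())
gfbSizes-merge _ _ _ (gfbSizes _ 1 0 [] _ none ())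

IsOptimal : Tree → Set
IsOptimal t = colless t ≡ c (leaves t)

node-optimal : ∀ {t u} → IsOptimal t → IsOptimal u → splitCost (leaves t) (leaves u) ≡ c (leaves t + leaves u) →
               IsOptimal (node t u)
node-optimal {t} {u} opt-t opt-u = trans (cong₂ (λ a b → ∣ leaves t - leaves u ∣ + a + b) opt-t opt-u)

gfbRun-optimal : ∀ f ts → All IsOptimal ts → GfbSizes (map leaves ts) → IsOptimal (gfbRun f ts)
gfbRun-optimal _       []           _                      _     = refl
gfbRun-optimal _       (_ ∷ [])     (opt ∷ [])             _     = opt
gfbRun-optimal zero    (_ ∷ _ ∷ _)  (opt ∷ _)              _     = opt
gfbRun-optimal (suc f) (t ∷ u ∷ ts) (opt-t ∷ opt-u ∷ opts) sizes =
  let (merge-optimal , sizes′) = gfbSizes-merge (leaves t) (leaves u) (map leaves ts) sizes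
      opt-tu                   = node-optimal {t} {u} opt-t opt-u merge-optimal
  in gfbRun-optimal f (insertBySize (node t u) ts)
       (All-resp-↭ {P = IsOptimal} (↭-sym (insertBySize-↭ (node t u) ts)) (opt-tu ∷ opts))
       (subst GfbSizes (sym (map-leaves-insertBySize (node t u) ts)) sizes′)

gfbRun-leaves : ∀ f ts → 0 < length ts → length ts ≤ suc f → leaves (gfbRun f ts) ≡ sum (map leaves ts)
gfbRun-leaves _       (_ ∷ [])     _ _          = sym (+-identityʳ _)
gfbRun-leaves (suc f) (t ∷ u ∷ ts) _ (s≤s len) = begin
  leaves (gfbRun f (insertBySize (node t u) ts))
    ≡⟨ gfbRun-leaves f (insertBySize (node t u) ts) (subst (0 <_) (sym length≡) z<s) (subst (_≤ suc f) (sym length≡) len) ⟩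
  sum (map leaves (insertBySize (node t u) ts))   ≡⟨ sum-↭ (map⁺ leaves (insertBySize-↭ (node t u) ts)) ⟩
  leaves t + leaves u + sum (map leaves ts)       ≡⟨ +-assoc (leaves t) (leaves u) _ ⟩
  leaves t + (leaves u + sum (map leaves ts))     ∎
  where
  open ≡-Reasoning
  length≡ : length (insertBySize (node t u) ts) ≡ suc (length ts)
  length≡ = ↭-length (insertBySize-↭ (node t u) ts)
gfbRun-leaves zero    (_ ∷ _ ∷ _)  _ (s≤s ())

sum-replicate-1 : ∀ n → sum (replicate n 1) ≡ n
sum-replicate-1 zero    = refl
sum-replicate-1 (suc n) = cong suc (sum-replicate-1 n)

gfb-optimal : ∀ n → IsOptimal (gfb n)
gfb-optimal n = gfbRun-optimal n (replicate n leaf) (replicate⁺ n refl)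
  (gfbSizes 1 n 0 [] one none (trans (map-replicate leaves n leaf) (sym (++-identityʳ _))))

gfb-leaves : ∀ {n} → 0 < n → leaves (gfb n) ≡ n
gfb-leaves {n} 0<n = begin
  leaves (gfb n)
    ≡⟨ gfbRun-leaves n (replicate n leaf) (subst (0 <_) (sym length≡n) 0<n) (subst (_≤ suc n) (sym length≡n) (n≤1+n n)) ⟩
  sum (map leaves (replicate n leaf))  ≡⟨ cong sum (map-replicate leaves n leaf) ⟩
  sum (replicate n 1)                  ≡⟨ sum-replicate-1 n ⟩
  n                                    ∎
  where
  open ≡-Reasoning
  length≡n : length (replicate n leaf) ≡ n
  length≡n = length-replicate n

gfb-isMinColless : ∀ {n} → 0 < n → IsMinColless n (colless (gfb n))
gfb-isMinColless {n} 0<n = (gfb n , gfb-leaves 0<n , refl) , λ T leaves≡n → begin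
  colless (gfb n)     ≡⟨ gfb-optimal n ⟩
  c (leaves (gfb n))  ≡⟨ cong c (trans (gfb-leaves 0<n) (sym leaves≡n)) ⟩
  c (leaves T)        ≤⟨ c-≤-colless T ⟩
  colless T           ∎
  where open ≤-Reasoning

hatSplit-straddles : ∀ {n k na nb} → 2 ^ (k ∸ 1) < n → n < 2 ^ k → HatSplit n k na nb →
                     Σ ℕ λ s → PowerOfTwo s × nb < s × s < na
hatSplit-straddles {k = 0} lo hi _ = ⊥-elim (<⇒≱ hi (<⇒≤ lo))
hatSplit-straddles {k = 1} lo hi _ = ⊥-elim (<⇒≱ hi lo)
hatSplit-straddles {n} {suc (suc k)} lo hi (inj₁ (_ , j , 0<j , j<Q , refl , refl)) =
  Q , powerOfTwo-2^ k , ∸-monoʳ-< 0<j (<⇒≤ j<Q) , ≤-trans Q<n∸Q (m≤m+n (n ∸ Q) j)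
  where
  Q = 2 ^ k
  Q<n∸Q : Q < n ∸ Q
  Q<n∸Q = subst (_< n ∸ Q) (m+n∸m≡n Q Q)
            (∸-monoˡ-< (subst (_< n) (2^[1+m]≡2^m+2^m k) lo) (m≤m+n Q Q))
hatSplit-straddles {n} {suc (suc k)} lo hi (inj₂ (inj₁ (_ , j , 0<j , j<Q , refl , refl))) =
  Q , powerOfTwo-2^ k , ∸-monoʳ-< 0<j (<⇒≤ j<Q) , ≤-trans Q<2Q (m≤m+n _ j)
  where
  Q = 2 ^ k
  Q<2Q : Q < 2 ^ suc k
  Q<2Q = subst (Q <_) (sym (2^[1+m]≡2^m+2^m k)) (m<m+n Q (m^n>0 2 k))
hatSplit-straddles {n} {suc (suc k)} lo hi (inj₂ (inj₂ (_ , j , 0<j , _ , refl , refl))) =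
  P , powerOfTwo-2^ (suc k) , ≤-<-trans (m∸n≤m (n ∸ P) j) n∸P<P , m<m+n P 0<j
  where
  P = 2 ^ suc k
  n∸P<P : n ∸ P < P
  n∸P<P = subst (n ∸ P <_) (m+n∸m≡n P P)
            (∸-monoˡ-< (subst (n <_) (2^[1+m]≡2^m+2^m (suc k)) hi) (<⇒≤ lo))

theorem6 : ∀ (n : ℕ) → 2 ^ (⌈log₂ n ⌉ ∸ 1) < n → n < 2 ^ ⌈log₂ n ⌉ →
    ∀ (Ta Tb : Tree) → leaves (node Ta Tb) ≡ n →
    HatSplit n ⌈log₂ n ⌉ (leaves Ta) (leaves Tb) →
    IsMinColless n (colless (gfb n)) × colless (gfb n) < colless (node Ta Tb)
theorem6 n lo hi Ta Tb leaves≡n split =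
  let (s , pow , nb<s , s<na) = hatSplit-straddles {k = ⌈log₂ n ⌉} lo hi split
      0<n                     = ≤-<-trans z≤n lo
  in gfb-isMinColless 0<n , (begin-strict
    colless (gfb n)           ≡⟨ gfb-optimal n ⟩
    c (leaves (gfb n))        ≡⟨ cong c (trans (gfb-leaves 0<n) (sym leaves≡n)) ⟩
    c (leaves Ta + leaves Tb) <⟨ c-<-colless Ta Tb pow nb<s s<na ⟩
    colless (node Ta Tb)      ∎)
  where open ≤-Reasoning
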